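{- Let $\mathbb{V}=U\oplus W$ be an $n$-dimensional vector space over a finite field $\mathcal{F}$ with $q$ elements, where $U$ and $W$ are nonzero subspaces. Then the girth of the direct sum graph $\Gamma_{U\oplus W}(\mathbb{V})$ is: $\infty$ if $n=2$, $\dim(W)=n-1$ and $q=2$; $3$ if $n=2$, $\dim(W)=n-1$ and $q\neq 2$; $\infty$ if $n=3$, $\dim(W)=n-1$ and $q=2$; $3$ if $n=3$, $\dim(W)=n-1$ and $q\neq 2$; $3$ if $n\geq 4$, $\dim(W)=n-1$ and $q\geq 2$; $3$ if $n\geq 4$, $\dim(W)\leq n-2$ and $q\geq 2$.
   Context: Let $\dim U=r$, $\dim W=s$, $r+s=n$. Fix a basis $\{\alpha_1,\dots,\alpha_r\}$ of $U$ and a basis $\{\beta_1,\dots,\beta_s\}$ of $W$; every $x\in\mathbb{V}$ is written uniquely as $x=\sum_i a_i\alpha_i+\sum_j b_j\beta_j$. The direct sum graph $\Gamma_{U\oplus W}(\mathbb{V})$ is the simple graph whose vertex set is $\{x=u+w: u\in U, w\in W, u\neq 0, w\neq 0\}$, in which two distinct vertices $x,y$ are adjacent iff there is an index $i$ such that the coefficient of $\alpha_i$ is nonzero in both $x$ and $y$, and there is an index $j$ such that the coefficient of $\beta_j$ is nonzero in both $x$ and $y$. The girth is the length of a shortest cycle, and $\infty$ if there is no cycle. -}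

module Defs where

open import Level using (Level; _⊔_)
open import Algebra.Bundles using (CommutativeRing)
open import Data.Nat using (ℕ; zero; suc; _<_; _≤_)
open import Data.Fin using (Fin; inject₁; fromℕ)
import Data.Fin as Fin
open import Data.Product using (Σ; _×_; ∃; ∃-syntax)
open import Relation.Nullary using (¬_)
open import Relation.Binary.PropositionalEquality using (_≡_)
import Relation.Binary.PropositionalEquality as ≡
open import Function.Bundles using (Bijection)

record Field (c ℓ : Level) : Set (Level.suc (c ⊔ ℓ)) where
  field
    commutativeRing : CommutativeRing c ℓ
  open CommutativeRing commutativeRing public
  field
    1≉0     : ¬ (1# ≈ 0#)
    inverse : ∀ x → ¬ (x ≈ 0#) → ∃[ y ] (x * y ≈ 1#)

HasCardinality : ∀ {c ℓ} → Field c ℓ → ℕ → Set (c ⊔ ℓ)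
HasCardinality F q = Bijection (CommutativeRing.setoid (Field.commutativeRing F)) (≡.setoid (Fin q))

module DirectSumGraph {c ℓ} (F : Field c ℓ) (r s : ℕ) where
  open Field F

  -- V = U ⊕ W, with dim U = r, dim W = s, written in coordinates w.r.t.
  -- fixed bases α₁..α_r of U and β₁..β_s of W.
  record Vec2 : Set c where
    constructor ⟨_,_⟩
    field
      a : Fin r → Carrier
      b : Fin s → Carrier
  open Vec2 public

  NonZeroVec : ∀ {m} → (Fin m → Carrier) → Set ℓ
  NonZeroVec v = ∃[ i ] ¬ (v i ≈ 0#)

  record Vertex : Set (c ⊔ ℓ) where
    constructor vtx
    field
      vec   : Vec2
      u≢0   : NonZeroVec (a vec)
      w≢0   : NonZeroVec (b vec)
  open Vertex public

  _≈V_ : Vertex → Vertex → Set ℓ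
  x ≈V y = (∀ i → a (vec x) i ≈ a (vec y) i) × (∀ j → b (vec x) j ≈ b (vec y) j)

  Adj : Vertex → Vertex → Set ℓ
  Adj x y = ¬ (x ≈V y)
          × (∃[ i ] (¬ (a (vec x) i ≈ 0#) × ¬ (a (vec y) i ≈ 0#)))
          × (∃[ j ] (¬ (b (vec x) j ≈ 0#) × ¬ (b (vec y) j ≈ 0#)))

  record Cycle (k : ℕ) : Set (c ⊔ ℓ) where
    field
      len≥3    : 3 ≤ k
      m        : ℕ
      k≡        : k ≡ suc m
      vs       : Fin (suc m) → Vertex
      distinct : ∀ i j → vs i ≈V vs j → i ≡ j
      step     : ∀ (i : Fin m) → Adj (vs (inject₁ i)) (vs (Fin.suc i))
      close    : Adj (vs (fromℕ m)) (vs Fin.zero)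

data ℕ∞ : Set where
  fin : ℕ → ℕ∞
  ∞   : ℕ∞

Girth : ∀ {c ℓ} (F : Field c ℓ) (r s : ℕ) → ℕ∞ → Set (c ⊔ ℓ)
Girth F r s (fin g) = Cycle g × (∀ k → k < g → ¬ Cycle k)
  where open DirectSumGraph F r s
Girth F r s ∞ = ∀ k → ¬ Cycle k
  where open DirectSumGraph F r s

-- A triangle gives girth 3. If F has an element v ∉ {0, 1}, the vertices
-- (1;1), (v,1,…;1) and (1;v,1,…) form one, and if dim V ≥ 4 a triangle can
-- be built from 0/1 coordinates alone. Over F₂ a vertex is determined by its
-- support; for (dim U, dim W) = (1, 1) or (1, 2) this makes the graph a star
-- centred at the all-ones vertex, and a star has no cycle.
module Submission where

open import Level using (_⊔_)
open import Data.Nat using (ℕ; suc; _+_; _∸_; _≤_; _≥_; s≤s; z≤n)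
open import Data.Nat.Properties using (<⇒≱; +-cancelʳ-≡)
open import Data.Fin using (Fin; opposite)
open import Data.Vec.Functional using (_∷_; [])
open import Data.Product using (_×_; _,_; proj₁; proj₂; ∃-syntax)
open import Data.Sum using (_⊎_; inj₁; inj₂)
open import Data.Unit using (⊤)
open import Data.Empty using (⊥; ⊥-elim)
open import Function using (const)
open import Function.Bundles using (Bijection)
open import Relation.Nullary using (¬_)
open import Relation.Binary.PropositionalEquality
  using (_≡_; _≢_; refl; cong; subst; subst₂)
import Relation.Binary.PropositionalEquality as ≡

open import Defs

pattern 0F = Fin.zero
pattern 1F = Fin.suc Fin.zero
pattern 2F = Fin.suc (Fin.suc Fin.zero)
pattern 3F = Fin.suc (Fin.suc (Fin.suc Fin.zero))

Fin2-cover : (i j k : Fin 2) → i ≢ j → k ≡ i ⊎ k ≡ j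
Fin2-cover 0F 0F _  0≢0 = ⊥-elim (0≢0 refl)
Fin2-cover 0F 1F 0F _   = inj₁ refl
Fin2-cover 0F 1F 1F _   = inj₂ refl
Fin2-cover 1F 0F 0F _   = inj₂ refl
Fin2-cover 1F 0F 1F _   = inj₁ refl
Fin2-cover 1F 1F _  1≢1 = ⊥-elim (1≢1 refl)

Fin2-opposite-cover : (j i : Fin 2) → i ≡ j ⊎ i ≡ opposite j
Fin2-opposite-cover 0F i = Fin2-cover 0F 1F i (λ ())
Fin2-opposite-cover 1F i = Fin2-cover 1F 0F i (λ ())

avoid-two : ∀ {n} (i j : Fin (3 + n)) → ∃[ k ] k ≢ i × k ≢ j
avoid-two 0F                    0F          = 1F , (λ ()) , (λ ())
avoid-two 0F                    1F          = 2F , (λ ()) , (λ ())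
avoid-two 0F                    (Fin.suc (Fin.suc _)) = 1F , (λ ()) , (λ ())
avoid-two 1F                    0F          = 2F , (λ ()) , (λ ())
avoid-two 1F                    (Fin.suc _) = 0F , (λ ()) , (λ ())
avoid-two (Fin.suc (Fin.suc _)) 0F          = 1F , (λ ()) , (λ ())
avoid-two (Fin.suc (Fin.suc _)) (Fin.suc _) = 0F , (λ ()) , (λ ())

dimensions-of-codim-1 : ∀ {r s n} → r + s ≡ suc n → s ≡ (r + s) ∸ 1 → r ≡ 1 × s ≡ n
dimensions-of-codim-1 {r} {s} {n} r+s≡1+n s≡r+s-1 = r≡1 , s≡n
  where
  s≡n : s ≡ n
  s≡n = ≡.trans s≡r+s-1 (cong (_∸ 1) r+s≡1+n)
  r≡1 : r ≡ 1
  r≡1 = +-cancelʳ-≡ n r 1 (≡.trans (cong (r +_) (≡.sym s≡n)) r+s≡1+n)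

Girth-cong : ∀ {c ℓ} {F : Field c ℓ} {r r′ s s′ g} →
             r ≡ r′ × s ≡ s′ → Girth F r′ s′ g → Girth F r s g
Girth-cong {F = F} {g = g} (r≡r′ , s≡s′) =
  subst₂ (λ r s → Girth F r s g) (≡.sym r≡r′) (≡.sym s≡s′)

module _ {c ℓ} (F : Field c ℓ) where
  open Field F using (Carrier; _≈_; 0#; 1#; 1≉0; sym; trans)

  third-element : ∀ {q} → HasCardinality F q → q ≢ 2 → ∃[ v ] ¬ v ≈ 0# × ¬ v ≈ 1#
  third-element {0} card _ with Bijection.to card 0#
  ... | ()
  third-element {1} card _ = ⊥-elim (1≉0 (injective (Fin1-≡ (to 1#) (to 0#))))
    where
    open Bijection card using (to; injective)
    Fin1-≡ : (i j : Fin 1) → i ≡ j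
    Fin1-≡ 0F 0F = refl
  third-element {2} _ q≢2 = ⊥-elim (q≢2 refl)
  third-element {suc (suc (suc _))} card _
    with avoid-two (Bijection.to card 0#) (Bijection.to card 1#)
  ... | k , k≢0 , k≢1 = v , (λ v≈0 → k≢0 (to-v≈ v≈0)) , (λ v≈1 → k≢1 (to-v≈ v≈1))
    where
    open Bijection card using (to; strictlySurjective) renaming (cong to to-cong)
    v = proj₁ (strictlySurjective k)
    to-v≈ : ∀ {w} → v ≈ w → k ≡ to w
    to-v≈ v≈w = ≡.trans (≡.sym (proj₂ (strictlySurjective k))) (to-cong v≈w)

  module Binary (card : HasCardinality F 2) where
    open Bijection card using (to; injective)

    zero-or-one : ∀ x → x ≈ 0# ⊎ x ≈ 1#
    zero-or-one x with Fin2-cover (to 0#) (to 1#) (to x) (λ e → 1≉0 (sym (injective e)))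
    ... | inj₁ e = inj₁ (injective e)
    ... | inj₂ e = inj₂ (injective e)

    nonzero⇒≈1 : ∀ {x} → ¬ x ≈ 0# → x ≈ 1#
    nonzero⇒≈1 {x} x≉0 with zero-or-one x
    ... | inj₁ x≈0 = ⊥-elim (x≉0 x≈0)
    ... | inj₂ x≈1 = x≈1

    zero-or-nonzero : ∀ x → x ≈ 0# ⊎ ¬ x ≈ 0#
    zero-or-nonzero x with zero-or-one x
    ... | inj₁ x≈0 = inj₁ x≈0
    ... | inj₂ x≈1 = inj₂ (λ x≈0 → 1≉0 (trans (sym x≈1) x≈0))

    nonzeros-≈ : ∀ {x y} → ¬ x ≈ 0# → ¬ y ≈ 0# → x ≈ y
    nonzeros-≈ x≉0 y≉0 = trans (nonzero⇒≈1 x≉0) (sym (nonzero⇒≈1 y≉0))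

    Fin1-nonzeros-≈ : ∀ {u v : Fin 1 → Carrier} → ∃[ i ] ¬ u i ≈ 0# → ∃[ i ] ¬ v i ≈ 0#
                    → ∀ i → u i ≈ v i
    Fin1-nonzeros-≈ (0F , u≉0) (0F , v≉0) 0F = nonzeros-≈ u≉0 v≉0

  module _ {r s : ℕ} where
    open DirectSumGraph F r s

    ≈V-sym : ∀ {x y} → x ≈V y → y ≈V x
    ≈V-sym (a≈ , b≈) = (λ i → sym (a≈ i)) , (λ j → sym (b≈ j))

    Adj-sym : ∀ x y → Adj x y → Adj y x
    Adj-sym x y (x≉y , (i , xᵢ≉0 , yᵢ≉0) , (j , xⱼ≉0 , yⱼ≉0)) =
      (λ y≈x → x≉y (≈V-sym {y} {x} y≈x)) , (i , yᵢ≉0 , xᵢ≉0) , (j , yⱼ≉0 , xⱼ≉0)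

    record Triangle : Set (c ⊔ ℓ) where
      field
        x y z : Vertex
        x∼y   : Adj x y
        y∼z   : Adj y z
        z∼x   : Adj z x

    triangle⇒girth3 : Triangle → Girth F r s (fin 3)
    triangle⇒girth3 t = triangle , λ k k<3 C → <⇒≱ k<3 (Cycle.len≥3 C)
      where
      open Triangle t
      triangle : Cycle 3
      triangle = record
        { len≥3    = s≤s (s≤s (s≤s z≤n))
        ; m        = 2
        ; k≡       = refl
        ; vs       = x ∷ y ∷ z ∷ []
        ; distinct = distinct
        ; step     = λ { 0F → x∼y ; 1F → y∼z }
        ; close    = z∼x
        }
        where
        distinct : ∀ i j → (x ∷ y ∷ z ∷ []) i ≈V (x ∷ y ∷ z ∷ []) j → i ≡ j
        distinct 0F 0F _ = refl
        distinct 1F 1F _ = refl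
        distinct 2F 2F _ = refl
        distinct 0F 1F e = ⊥-elim (proj₁ x∼y e)
        distinct 1F 0F e = ⊥-elim (proj₁ (Adj-sym x y x∼y) e)
        distinct 1F 2F e = ⊥-elim (proj₁ y∼z e)
        distinct 2F 1F e = ⊥-elim (proj₁ (Adj-sym y z y∼z) e)
        distinct 2F 0F e = ⊥-elim (proj₁ z∼x e)
        distinct 0F 2F e = ⊥-elim (proj₁ (Adj-sym z x z∼x) e)

    record NonBacktrackingWalk₃ : Set (c ⊔ ℓ) where
      field
        w₀ w₁ w₂ w₃ : Vertex
        w₀∼w₁ : Adj w₀ w₁
        w₁∼w₂ : Adj w₁ w₂
        w₂∼w₃ : Adj w₂ w₃
        w₀≉w₂ : ¬ w₀ ≈V w₂
        w₁≉w₃ : ¬ w₁ ≈V w₃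

    cycle⇒walk : ∀ {k} → Cycle k → NonBacktrackingWalk₃
    cycle⇒walk record { len≥3 = s≤s (s≤s ()) ; m = 1 ; k≡ = refl }
    cycle⇒walk record { m = 2 ; k≡ = refl ; vs = vs ; distinct = distinct
                      ; step = step ; close = close }
      = record { w₀ = vs 0F ; w₁ = vs 1F ; w₂ = vs 2F ; w₃ = vs 0F
               ; w₀∼w₁ = step 0F ; w₁∼w₂ = step 1F ; w₂∼w₃ = close
               ; w₀≉w₂ = λ e → 0≢2 (distinct 0F 2F e)
               ; w₁≉w₃ = proj₁ (Adj-sym (vs 0F) (vs 1F) (step 0F)) }
      where
      0≢2 : 0F ≢ 2F
      0≢2 ()
    cycle⇒walk record { m = suc (suc (suc _)) ; k≡ = refl ; vs = vs ; distinct = distinct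
                      ; step = step }
      = record { w₀ = vs 0F ; w₁ = vs 1F ; w₂ = vs 2F ; w₃ = vs 3F
               ; w₀∼w₁ = step 0F ; w₁∼w₂ = step 1F ; w₂∼w₃ = step 2F
               ; w₀≉w₂ = λ e → 0≢2 (distinct 0F 2F e)
               ; w₁≉w₃ = λ e → 1≢3 (distinct 1F 3F e) }
      where
      0≢2 : 0F ≢ 2F
      0≢2 ()
      1≢3 : 1F ≢ 3F
      1≢3 ()

    star-acyclic : ∀ {p} (Centre : Vertex → Set p)
                 → (∀ x y → Centre x → Centre y → x ≈V y)
                 → (∀ x y → Adj x y → Centre x ⊎ Centre y)
                 → Girth F r s ∞
    star-acyclic Centre centres-≈ cover _ C = no-walk (cycle⇒walk C)
      where
      no-walk : NonBacktrackingWalk₃ → ⊥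
      no-walk record { w₀ = w₀ ; w₁ = w₁ ; w₂ = w₂ ; w₃ = w₃
                     ; w₀∼w₁ = w₀∼w₁ ; w₁∼w₂ = w₁∼w₂ ; w₂∼w₃ = w₂∼w₃
                     ; w₀≉w₂ = w₀≉w₂ ; w₁≉w₃ = w₁≉w₃ }
        with cover w₀ w₁ w₀∼w₁ | cover w₁ w₂ w₁∼w₂ | cover w₂ w₃ w₂∼w₃
      ... | inj₁ c₀ | inj₁ c₁ | _      = proj₁ w₀∼w₁ (centres-≈ w₀ w₁ c₀ c₁)
      ... | inj₁ c₀ | inj₂ c₂ | _      = w₀≉w₂ (centres-≈ w₀ w₂ c₀ c₂)
      ... | inj₂ c₁ | inj₂ c₂ | _      = proj₁ w₁∼w₂ (centres-≈ w₁ w₂ c₁ c₂)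
      ... | inj₂ c₁ | inj₁ _  | inj₁ c₂ = proj₁ w₁∼w₂ (centres-≈ w₁ w₂ c₁ c₂)
      ... | inj₂ c₁ | inj₁ _  | inj₂ c₃ = w₁≉w₃ (centres-≈ w₁ w₃ c₁ c₃)

  module _ {r s : ℕ} where
    private
      module UW = DirectSumGraph F r s
      module WU = DirectSumGraph F s r

    swap : WU.Vertex → UW.Vertex
    swap (WU.vtx v u≢0 w≢0) = UW.vtx UW.⟨ WU.b v , WU.a v ⟩ w≢0 u≢0

    swap-Adj : ∀ x y → WU.Adj x y → UW.Adj (swap x) (swap y)
    swap-Adj _ _ (x≉y , i , j) = (λ (b≈ , a≈) → x≉y (a≈ , b≈)) , j , i

    swap-triangle : Triangle {s} {r} → Triangle {r} {s}
    swap-triangle t = record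
      { x = swap x ; y = swap y ; z = swap z
      ; x∼y = swap-Adj x y x∼y ; y∼z = swap-Adj y z y∼z ; z∼x = swap-Adj z x z∼x }
      where open Triangle t

  module _ {r s : ℕ} where
    open DirectSumGraph F (suc r) (suc s)

    triangle-of-third-element : ∀ {v} → ¬ v ≈ 0# → ¬ v ≈ 1# → Triangle {suc r} {suc s}
    triangle-of-third-element {v} v≉0 v≉1 = record
      { x   = vtx ⟨ const 1# , const 1# ⟩ (0F , 1≉0) (0F , 1≉0)
      ; y   = vtx ⟨ v ∷ const 1# , const 1# ⟩ (0F , v≉0) (0F , 1≉0)
      ; z   = vtx ⟨ const 1# , v ∷ const 1# ⟩ (0F , 1≉0) (0F , v≉0)
      ; x∼y = (λ e → v≉1 (sym (proj₁ e 0F))) , (0F , 1≉0 , v≉0) , (0F , 1≉0 , 1≉0)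
      ; y∼z = (λ e → v≉1 (proj₁ e 0F)) , (0F , v≉0 , 1≉0) , (0F , 1≉0 , v≉0)
      ; z∼x = (λ e → v≉1 (proj₂ e 0F)) , (0F , 1≉0 , 1≉0) , (0F , v≉0 , 1≉0)
      }

  module _ {r s : ℕ} where
    open DirectSumGraph F (2 + r) (2 + s)

    triangle-of-dims-2-2 : Triangle {2 + r} {2 + s}
    triangle-of-dims-2-2 = record
      { x   = vtx ⟨ const 1# , const 1# ⟩ (0F , 1≉0) (0F , 1≉0)
      ; y   = vtx ⟨ 0# ∷ const 1# , const 1# ⟩ (1F , 1≉0) (0F , 1≉0)
      ; z   = vtx ⟨ const 1# , 0# ∷ const 1# ⟩ (0F , 1≉0) (1F , 1≉0)
      ; x∼y = (λ e → 1≉0 (proj₁ e 0F)) , (1F , 1≉0 , 1≉0) , (0F , 1≉0 , 1≉0)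
      ; y∼z = (λ e → 1≉0 (sym (proj₁ e 0F))) , (1F , 1≉0 , 1≉0) , (1F , 1≉0 , 1≉0)
      ; z∼x = (λ e → 1≉0 (sym (proj₂ e 0F))) , (0F , 1≉0 , 1≉0) , (1F , 1≉0 , 1≉0)
      }

  module _ {r s : ℕ} where
    open DirectSumGraph F (3 + r) (1 + s)

    triangle-of-dims-3-1 : Triangle {3 + r} {1 + s}
    triangle-of-dims-3-1 = record
      { x   = vtx ⟨ const 1# , const 1# ⟩ (0F , 1≉0) (0F , 1≉0)
      ; y   = vtx ⟨ 0# ∷ const 1# , const 1# ⟩ (1F , 1≉0) (0F , 1≉0)
      ; z   = vtx ⟨ 1# ∷ 0# ∷ const 1# , const 1# ⟩ (0F , 1≉0) (0F , 1≉0)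
      ; x∼y = (λ e → 1≉0 (proj₁ e 0F)) , (1F , 1≉0 , 1≉0) , (0F , 1≉0 , 1≉0)
      ; y∼z = (λ e → 1≉0 (sym (proj₁ e 0F))) , (2F , 1≉0 , 1≉0) , (0F , 1≉0 , 1≉0)
      ; z∼x = (λ e → 1≉0 (sym (proj₁ e 1F))) , (0F , 1≉0 , 1≉0) , (0F , 1≉0 , 1≉0)
      }

  girth3-of-cardinality≢2 : ∀ {q} r s → HasCardinality F q → q ≢ 2 →
                            Girth F (suc r) (suc s) (fin 3)
  girth3-of-cardinality≢2 r s card q≢2 with third-element card q≢2
  ... | _ , v≉0 , v≉1 = triangle⇒girth3 (triangle-of-third-element {r} {s} v≉0 v≉1)

  girth3-of-dims≥4 : ∀ r s → 4 ≤ suc r + suc s → Girth F (suc r) (suc s) (fin 3)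
  girth3-of-dims≥4 (suc (suc _)) _ _ = triangle⇒girth3 triangle-of-dims-3-1
  girth3-of-dims≥4 _ (suc (suc _)) _ = triangle⇒girth3 (swap-triangle triangle-of-dims-3-1)
  girth3-of-dims≥4 1 1 _ = triangle⇒girth3 triangle-of-dims-2-2
  girth3-of-dims≥4 0 0 (s≤s (s≤s ()))
  girth3-of-dims≥4 0 1 (s≤s (s≤s (s≤s ())))
  girth3-of-dims≥4 1 0 (s≤s (s≤s (s≤s ())))

  module _ (card : HasCardinality F 2) where
    open Binary card

    girth-F₂-1-1 : Girth F 1 1 ∞
    girth-F₂-1-1 =
      star-acyclic {1} {1} (λ _ → ⊤) (λ x y _ _ → all-≈V x y) (λ _ _ _ → inj₁ _)
      where
      open DirectSumGraph F 1 1
      all-≈V : ∀ x y → x ≈V y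
      all-≈V x y = Fin1-nonzeros-≈ (u≢0 x) (u≢0 y) , Fin1-nonzeros-≈ (w≢0 x) (w≢0 y)

    girth-F₂-1-2 : Girth F 1 2 ∞
    girth-F₂-1-2 = star-acyclic {1} {2} FullSupportW centres-≈ cover
      where
      open DirectSumGraph F 1 2
      FullSupportW : Vertex → Set ℓ
      FullSupportW x = ∀ j → ¬ b (vec x) j ≈ 0#
      centres-≈ : ∀ x y → FullSupportW x → FullSupportW y → x ≈V y
      centres-≈ x y x-full y-full =
        Fin1-nonzeros-≈ (u≢0 x) (u≢0 y) , λ j → nonzeros-≈ (x-full j) (y-full j)
      full : ∀ {v : Fin 2 → Carrier} j → ¬ v j ≈ 0# → ¬ v (opposite j) ≈ 0# →
             ∀ i → ¬ v i ≈ 0#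
      full j vⱼ≉0 vⱼ′≉0 i with Fin2-opposite-cover j i
      ... | inj₁ refl = vⱼ≉0
      ... | inj₂ refl = vⱼ′≉0
      cover : ∀ x y → Adj x y → FullSupportW x ⊎ FullSupportW y
      cover x y (x≉y , _ , j , xⱼ≉0 , yⱼ≉0)
        with zero-or-nonzero (b (vec x) (opposite j)) | zero-or-nonzero (b (vec y) (opposite j))
      ... | inj₂ xⱼ′≉0 | _           = inj₁ (full j xⱼ≉0 xⱼ′≉0)
      ... | inj₁ _     | inj₂ yⱼ′≉0 = inj₂ (full j yⱼ≉0 yⱼ′≉0)
      ... | inj₁ xⱼ′≈0 | inj₁ yⱼ′≈0 = ⊥-elim (x≉y (Fin1-nonzeros-≈ (u≢0 x) (u≢0 y) , same-b))
        where
        same-b : ∀ i → b (vec x) i ≈ b (vec y) i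
        same-b i with Fin2-opposite-cover j i
        ... | inj₁ refl = nonzeros-≈ xⱼ≉0 yⱼ≉0
        ... | inj₂ refl = trans xⱼ′≈0 (sym yⱼ′≈0)

theorem3p6 : ∀ {c ℓ} (F : Field c ℓ) (q : ℕ) → HasCardinality F q →
    (r s : ℕ) → 1 ≤ r → 1 ≤ s →
      ((r + s ≡ 2 → s ≡ (r + s) ∸ 1 → q ≡ 2 → Girth F r s ∞)
      × (r + s ≡ 2 → s ≡ (r + s) ∸ 1 → ¬ (q ≡ 2) → Girth F r s (fin 3))
      × (r + s ≡ 3 → s ≡ (r + s) ∸ 1 → q ≡ 2 → Girth F r s ∞)
      × (r + s ≡ 3 → s ≡ (r + s) ∸ 1 → ¬ (q ≡ 2) → Girth F r s (fin 3))
      × (r + s ≥ 4 → s ≡ (r + s) ∸ 1 → q ≥ 2 → Girth F r s (fin 3))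
      × (r + s ≥ 4 → s ≤ (r + s) ∸ 2 → q ≥ 2 → Girth F r s (fin 3)))
theorem3p6 F q card (suc r) (suc s) _ _ =
    (λ n≡2 s≡n-1 q≡2 → Girth-cong (dimensions-of-codim-1 n≡2 s≡n-1) (girth-F₂-1-1 F (F₂ q≡2)))
  , (λ _ _ q≢2 → girth3-of-cardinality≢2 F r s card q≢2)
  , (λ n≡3 s≡n-1 q≡2 → Girth-cong (dimensions-of-codim-1 n≡3 s≡n-1) (girth-F₂-1-2 F (F₂ q≡2)))
  , (λ _ _ q≢2 → girth3-of-cardinality≢2 F r s card q≢2)
  , (λ n≥4 _ _ → girth3-of-dims≥4 F r s n≥4)
  , (λ n≥4 _ _ → girth3-of-dims≥4 F r s n≥4)
  where
  F₂ : q ≡ 2 → HasCardinality F 2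
  F₂ q≡2 = subst (HasCardinality F) q≡2 card
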